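{- Let $\mathcal Q$ be any set of generalized quantifiers of type $(1)$ (no monotonicity or other condition is assumed), let $\psi$ be a formula of $IF(\mathcal Q)$, let $M$ be a structure and let $X$ be a team on $M$ suitable for $\psi$. If $M,X\models\psi$, then $M,Y\models\psi$ for every $Y\subseteq X$.
   Context: A generalized quantifier of type $(1)$ is a class $Q$ of structures $(M,S)$ with $S$ unary; its local version on the domain of a structure $M$ is $Q^M=\{S\subseteq M : (M,S)\in Q\}\subseteq\wp(M)$. An assignment $s$ on $M$ is a function from a finite set of variables $dom(s)$ to $M$; $s(a/v)$ is the assignment with domain $dom(s)\cup\{v\}$ mapping $v$ to $a$ and agreeing with $s$ elsewhere. A team $X$ on $M$ is a set of assignments with a common domain $dom(X)$. For a set $V$ of variables, $s\sim_V s'$ means $s(x)=s'(x)$ for all $x\in dom(s)\setminus V$; a function $F:X\to\wp(M)$ is $V$-uniform if $s\sim_V s'$ implies $F(s)=F(s')$ for $s,s'\in X$. Write $X[F/v]=\{s(a/v): s\in X, a\in F(s)\}$ and $X[M/v]=\{s(a/v): s\in X, a\in M\}$. Formulas of $IF(\mathcal Q)$: atomic first-order formulas $\alpha$, negated atomic formulas $\neg\alpha$, $\psi\land\chi$, $\psi\lor\chi$, $(\exists v/V)\psi$, $(\forall v/V)\psi$, and $(Qv/V)\psi$ for $Q\in\mathcal Q$, where $v$ is a variable and $V$ a finite set of variables. Free variables: $FV(\alpha)=FV(\neg\alpha)$ is the set of variables in $\alpha$; $FV(\psi\land\chi)=FV(\psi\lor\chi)=FV(\psi)\cup FV(\chi)$;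 $FV((\mathsf Qv/V)\psi)=(FV(\psi)\setminus\{v\})\cup V$ for any quantifier symbol $\mathsf Q$. $X$ is suitable for $\psi$ if $dom(X)\supseteq FV(\psi)$. Team semantics: $M,X\models\alpha$ (resp. $\neg\alpha$) iff every $s\in X$ satisfies $\alpha$ (resp. $\neg\alpha$) in the Tarskian sense; $M,X\models\psi\land\chi$ iff $M,X\models\psi$ and $M,X\models\chi$; $M,X\models\psi\lor\chi$ iff there are $Y,Z$ with $Y\cup Z=X$, $M,Y\models\psi$, $M,Z\models\chi$; $M,X\models(\forall v/V)\psi$ iff $M,X[M/v]\models\psi$; $M,X\models(\exists v/V)\psi$ iff $M,X[F/v]\models\psi$ for some $V$-uniform $F:X\to\wp(M)\setminus\{\emptyset\}$; $M,X\models(Qv/V)\psi$ iff $M,X[F/v]\models\psi$ for some $V$-uniform $F:X\to Q^M$. -}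

module Defs where

import Level
open import Level using (Lift)
open import Data.Nat using (ℕ)
open import Data.Nat.Properties using (_≟_)
open import Data.List using (List; []; _∷_; _++_)
open import Data.List.Membership.Propositional using (_∈_; _∉_)
open import Data.Vec using (Vec; []; _∷_)
open import Data.Maybe using (Maybe; just; nothing)
open import Data.Product using (Σ; Σ-syntax; ∃; ∃-syntax; _×_; _,_)
open import Data.Sum using (_⊎_)
open import Data.Unit using (⊤)
open import Relation.Nullary using (¬_; Dec; yes; no)
open import Relation.Binary.PropositionalEquality using (_≡_; _≢_)

record Signature : Set₁ where
  field
    Fun    : Set
    fArity : Fun → ℕ
    Rel    : Set
    rArity : Rel → ℕ
open Signature public

record Structure (L : Signature) : Set₁ where
  field
    Dom  : Set
    funI : (f : Fun L) → Vec Dom (fArity L f) → Dom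
    relI : (R : Rel L) → Vec Dom (rArity L R) → Set
open Structure public

-- Generalized quantifiers of type (1):
-- a class of structures (A , S) with S ⊆ A (S a unary predicate).
-- Q A S  means  (A , S) ∈ Q.  Its local version on A is  Q^A = Q A.

GenQuantifier : Set₁
GenQuantifier = (A : Set) → (A → Set) → Set

localQ : {L : Signature} → GenQuantifier → (M : Structure L) → (Dom M → Set) → Set
localQ Q M = Q (Dom M)

-- Syntax of IF(𝒬).  Variables are natural numbers; 𝒬 is given as
-- an indexed family  QSym → GenQuantifier  of quantifier symbols.

data Term (L : Signature) : Set where
  var : ℕ → Term L
  app : (f : Fun L) → Vec (Term L) (fArity L f) → Term L

data Atom (L : Signature) : Set where
  rel : (R : Rel L) → Vec (Term L) (rArity L R) → Atom L
  eq  : Term L → Term L → Atom L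

data Formula (L : Signature) (QSym : Set) : Set where
  atom  : Atom L → Formula L QSym
  natom : Atom L → Formula L QSym
  _∧'_  : Formula L QSym → Formula L QSym → Formula L QSym
  _∨'_  : Formula L QSym → Formula L QSym → Formula L QSym
  ex    : ℕ → List ℕ → Formula L QSym → Formula L QSym  -- (∃ v / V) ψ
  all   : ℕ → List ℕ → Formula L QSym → Formula L QSym  -- (∀ v / V) ψ
  gq    : QSym → ℕ → List ℕ → Formula L QSym → Formula L QSym  -- (Q v / V) ψ

mutual
  fvT : {L : Signature} → Term L → List ℕ
  fvT (var x)    = x ∷ []
  fvT (app f ts) = fvTs ts

  fvTs : {L : Signature} {n : ℕ} → Vec (Term L) n → List ℕ
  fvTs []       = []
  fvTs (t ∷ ts) = fvT t ++ fvTs ts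

fvA : {L : Signature} → Atom L → List ℕ
fvA (rel R ts) = fvTs ts
fvA (eq t u)   = fvT t ++ fvT u

_∈FV_ : {L : Signature} {QSym : Set} → ℕ → Formula L QSym → Set
x ∈FV atom α    = x ∈ fvA α
x ∈FV natom α   = x ∈ fvA α
x ∈FV (ψ ∧' χ)  = x ∈FV ψ ⊎ x ∈FV χ
x ∈FV (ψ ∨' χ)  = x ∈FV ψ ⊎ x ∈FV χ
x ∈FV ex v V ψ  = (x ∈FV ψ × x ≢ v) ⊎ x ∈ V
x ∈FV all v V ψ = (x ∈FV ψ × x ≢ v) ⊎ x ∈ V
x ∈FV gq q v V ψ = (x ∈FV ψ × x ≢ v) ⊎ x ∈ V

Assignment : Set → Set
Assignment A = ℕ → Maybe A

update : {A : Set} → Assignment A → ℕ → A → Assignment A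
update s v a x with x ≟ v
... | yes _ = just a
... | no  _ = s x

Team : Set → Set₁
Team A = Assignment A → Set

_⊆T_ : {A : Set} → Team A → Team A → Set
Y ⊆T X = ∀ s → Y s → X s

IsTeamOn : {A : Set} → Team A → List ℕ → Set
IsTeamOn X D = ∀ s → X s → ∀ x →
  (x ∈ D → ∃[ a ] s x ≡ just a) × (x ∉ D → s x ≡ nothing)

Suitable : {L : Signature} {QSym : Set} → List ℕ → Formula L QSym → Set
Suitable D ψ = ∀ x → x ∈FV ψ → x ∈ D

sim : {A : Set} → List ℕ → Assignment A → Assignment A → Set
sim V s s' = ∀ x a → s x ≡ just a → x ∉ V → s' x ≡ just a

Uniform : {A : Set} → Team A → List ℕ → (Assignment A → A → Set) → Set
Uniform X V F = ∀ s s' → X s → X s' → sim V s s' →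
  ∀ a → (F s a → F s' a) × (F s' a → F s a)

extend : {A : Set} → Team A → (Assignment A → A → Set) → ℕ → Team A
extend X F v t = ∃[ s ] ∃[ a ] (X s × F s a × (∀ x → t x ≡ update s v a x))

extendAll : {A : Set} → Team A → ℕ → Team A
extendAll X v = extend X (λ _ _ → ⊤) v

module _ {L : Signature} (M : Structure L) where
  mutual
    evalT : Assignment (Dom M) → Term L → Maybe (Dom M)
    evalT s (var x)    = s x
    evalT s (app f ts) with evalTs s ts
    ... | just as = just (funI M f as)
    ... | nothing = nothing

    evalTs : {n : ℕ} → Assignment (Dom M) → Vec (Term L) n → Maybe (Vec (Dom M) n)
    evalTs s []       = just []
    evalTs s (t ∷ ts) with evalT s t | evalTs s ts
    ... | just a  | just as = just (a ∷ as)
    ... | just a  | nothing = nothing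
    ... | nothing | _       = nothing

  holds : Assignment (Dom M) → Atom L → Set
  holds s (rel R ts) = ∃[ as ] (evalTs s ts ≡ just as × relI M R as)
  holds s (eq t u)   = ∃[ a ] ∃[ b ] (evalT s t ≡ just a × evalT s u ≡ just b × a ≡ b)

  holdsNot : Assignment (Dom M) → Atom L → Set
  holdsNot s (rel R ts) = ∃[ as ] (evalTs s ts ≡ just as × ¬ relI M R as)
  holdsNot s (eq t u)   = ∃[ a ] ∃[ b ] (evalT s t ≡ just a × evalT s u ≡ just b × ¬ a ≡ b)

Sat : {L : Signature} {QSym : Set} → (QSym → GenQuantifier) →
      (M : Structure L) → Team (Dom M) → Formula L QSym → Set₁
Sat 𝒬 M X (atom α)  = Lift _ (∀ s → X s → holds M s α)
Sat 𝒬 M X (natom α) = Lift _ (∀ s → X s → holdsNot M s α)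
Sat 𝒬 M X (ψ ∧' χ)  = Sat 𝒬 M X ψ × Sat 𝒬 M X χ
Sat 𝒬 M X (ψ ∨' χ)  = Σ[ Y ∈ Team (Dom M) ] Σ[ Z ∈ Team (Dom M) ]
  ((Y ⊆T X) × (Z ⊆T X) × (∀ s → X s → Y s ⊎ Z s) × Sat 𝒬 M Y ψ × Sat 𝒬 M Z χ)
Sat 𝒬 M X (all v V ψ) = Sat 𝒬 M (extendAll X v) ψ
Sat 𝒬 M X (ex v V ψ)  = Σ[ F ∈ (Assignment (Dom M) → Dom M → Set) ]
  (Lift (Level.suc Level.zero) (Uniform X V F × (∀ s → X s → ∃[ a ] F s a)) × Sat 𝒬 M (extend X F v) ψ)
Sat 𝒬 M X (gq q v V ψ) = Σ[ F ∈ (Assignment (Dom M) → Dom M → Set) ]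
  (Lift (Level.suc Level.zero) (Uniform X V F × (∀ s → X s → localQ (𝒬 q) M (F s))) × Sat 𝒬 M (extend X F v) ψ)

module Submission where

-- The proof is a structural induction on ψ and uses no property of the
-- quantifiers in 𝒬: each clause of the semantics only asks for
--   * pointwise conditions on the members of the team (literals, the
--     non-emptiness of existential choices, membership of F(s) in Q^M),
--   * V-uniformity of a choice function F, which is a condition on pairs
--     of members of the team, and
--   * satisfaction in a team built from X monotonically (X[F/v], X[M/v],
--     or the two halves of a split of X).
-- All three survive restriction to a subteam Y ⊆ X: pointwise conditions
-- and uniformity restrict trivially, X[F/v] is monotone in X, and a split
-- Y₁ ∪ Z₁ of X induces the split (Y ∩ Y₁) ∪ (Y ∩ Z₁) of Y.

open import Defs
open import Data.Nat using (ℕ)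
open import Data.List using (List)
open import Level using (Lift; lift)
open import Data.Product using (_×_; _,_; proj₁; proj₂; ∃)
open import Data.Sum using (_⊎_; map)

module _ {A : Set} where

  _∩T_ : Team A → Team A → Team A
  (Y ∩T Z) s = Y s × Z s

  restrict-pointwise : {P : Assignment A → Set} {X Y : Team A} →
    Y ⊆T X → (∀ s → X s → P s) → ∀ s → Y s → P s
  restrict-pointwise Y⊆X p s ys = p s (Y⊆X s ys)

  restrict-uniform : {X Y : Team A} {V : List ℕ} {F : Assignment A → A → Set} →
    Y ⊆T X → Uniform X V F → Uniform Y V F
  restrict-uniform Y⊆X u s s' ys ys' = u s s' (Y⊆X s ys) (Y⊆X s' ys')

  -- A uniform choice function whose values all satisfy P on X is one on
  -- any subteam; this covers both (∃v/V) (P = non-empty) and (Qv/V) (P = Q^M).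
  restrict-choice : (P : (A → Set) → Set) {X Y : Team A} {V : List ℕ}
    {F : Assignment A → A → Set} → Y ⊆T X →
    Lift (Level.suc Level.zero) (Uniform X V F × (∀ s → X s → P (F s))) →
    Lift (Level.suc Level.zero) (Uniform Y V F × (∀ s → Y s → P (F s)))
  restrict-choice P Y⊆X (lift (u , p)) =
    lift (restrict-uniform Y⊆X u , restrict-pointwise Y⊆X p)

  extend-mono : {X Y : Team A} (F : Assignment A → A → Set) (v : ℕ) →
    Y ⊆T X → extend Y F v ⊆T extend X F v
  extend-mono F v Y⊆X t (s , a , ys , fa , t≡) = s , a , Y⊆X s ys , fa , t≡

  restrict-cover : {X Y Y₁ Z₁ : Team A} → Y ⊆T X →
    (∀ s → X s → Y₁ s ⊎ Z₁ s) → ∀ s → Y s → (Y ∩T Y₁) s ⊎ (Y ∩T Z₁) s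
  restrict-cover Y⊆X cover s ys = map (ys ,_) (ys ,_) (cover s (Y⊆X s ys))

module _ {L : Signature} {QSym : Set} (𝒬 : QSym → GenQuantifier)
         (M : Structure L) where

  downward-closed : (ψ : Formula L QSym) {X Y : Team (Dom M)} →
    Y ⊆T X → Sat 𝒬 M X ψ → Sat 𝒬 M Y ψ
  downward-closed (atom α)  Y⊆X (lift h) = lift (restrict-pointwise Y⊆X h)
  downward-closed (natom α) Y⊆X (lift h) = lift (restrict-pointwise Y⊆X h)
  downward-closed (ψ ∧' χ)  Y⊆X (hψ , hχ) =
    downward-closed ψ Y⊆X hψ , downward-closed χ Y⊆X hχ
  downward-closed (ψ ∨' χ) {Y = Y} Y⊆X (Y₁ , Z₁ , _ , _ , cover , hψ , hχ) =
    Y ∩T Y₁ , Y ∩T Z₁ , (λ _ → proj₁) , (λ _ → proj₁) ,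
    restrict-cover Y⊆X cover ,
    downward-closed ψ (λ _ → proj₂) hψ ,
    downward-closed χ (λ _ → proj₂) hχ
  downward-closed (all v V ψ) Y⊆X h =
    downward-closed ψ (extend-mono _ v Y⊆X) h
  downward-closed (ex v V ψ) Y⊆X (F , choice , h) =
    F , restrict-choice (λ S → ∃ S) Y⊆X choice , downward-closed ψ (extend-mono F v Y⊆X) h
  downward-closed (gq q v V ψ) Y⊆X (F , choice , h) =
    F , restrict-choice (localQ (𝒬 q) M) Y⊆X choice , downward-closed ψ (extend-mono F v Y⊆X) h

mainTheorem1 : (L : Signature) (QSym : Set) (𝒬 : QSym → GenQuantifier)
    (M : Structure L) (ψ : Formula L QSym) (X : Team (Dom M)) (D : List ℕ) →
    IsTeamOn X D → Suitable D ψ → Sat 𝒬 M X ψ →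
    (Y : Team (Dom M)) → Y ⊆T X → Sat 𝒬 M Y ψ
mainTheorem1 L QSym 𝒬 M ψ X D _ _ X⊨ψ Y Y⊆X = downward-closed 𝒬 M ψ Y⊆X X⊨ψ
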